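{- Let $\mathrm{qmsg}$ be the queue automaton. Then for every state $(\mathit{msgs}, q) \in \mathrm{reachable}\ \mathrm{qmsg}\ (\lambda a.\ \mathrm{True})$ and every transition $((\mathit{msgs}, q), a, (\mathit{msgs}', q')) \in \mathrm{trans}\ \mathrm{qmsg}$: if $a = \mathrm{receive}\ m$ for some message $m$, then $\mathrm{set}\ \mathit{msgs}' \subseteq \mathrm{set}(\mathit{msgs} @ [m])$; and otherwise $\mathrm{set}\ \mathit{msgs}' \subseteq \mathrm{set}\ \mathit{msgs}$.
   Context: Data states of the queue are lists of messages; $@$ is list concatenation, $\mathrm{hd}$ and $\mathrm{tl}$ are head and tail, and $\mathrm{set}$ gives the set of elements of a list. The specification $\Gamma_{qmsg}$ has one process name $\mathrm{Qmsg}$ with (labels omitted) $\Gamma_{qmsg}\,\mathrm{Qmsg} = \mathrm{receive}(\lambda msg\ msgs.\ msgs@[msg]).\mathrm{call}(\mathrm{Qmsg}) \ \oplus\ \langle\lambda msgs.\ \text{if } msgs\neq[\,] \text{ then } \{msgs\} \text{ else } \emptyset\rangle\big(\mathrm{send}(\lambda msgs.\ \mathrm{hd}\,msgs).\big([\![\lambda msgs.\ \mathrm{tl}\,msgs]\!]\,\mathrm{call}(\mathrm{Qmsg}) \oplus \mathrm{receive}(\lambda msg\ msgs.\ \mathrm{tl}\,msgs@[msg]).\mathrm{call}(\mathrm{Qmsg})\big) \oplus \mathrm{receive}(\lambda msg\ msgs.\ msgs@[msg]).\mathrm{call}(\mathrm{Qmsg})\big)$. States are pairs $(\xi,p)$ of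 a data state and a process term, with the operational semantics: $(\xi,[\![u]\!]p)\xrightarrow{\tau}(u\,\xi,p)$; $(\xi,\langle g\rangle p)\xrightarrow{\tau}(\xi',p)$ for each $\xi'\in g\,\xi$; $(\xi,\mathrm{send}(s).p)\xrightarrow{\mathrm{send}(s\,\xi)}(\xi,p)$; $(\xi,\mathrm{receive}(u).p)\xrightarrow{\mathrm{receive}\,m}(u\,m\,\xi,p)$ for every message $m$; $(\xi,p\oplus q)$ has all transitions of $(\xi,p)$ and of $(\xi,q)$; $(\xi,\mathrm{call}(pn))$ has all transitions of $(\xi,\Gamma\,pn)$. The automaton $\mathrm{qmsg}$ has initial states $\{([\,],\Gamma_{qmsg}\,\mathrm{Qmsg})\}$ and transitions given by this semantics for $\Gamma_{qmsg}$. For an automaton $A$ and action predicate $I$, $\mathrm{reachable}\ A\ I$ is the smallest set containing the initial states and closed under transitions $(s,a,s')$ with $I\,a$. -}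

module Defs where

open import Level using (0ℓ)
open import Data.List using (List; []; _∷_; _++_; [_])
open import Data.Product using (_×_; _,_)
open import Data.Unit using (⊤)
open import Relation.Unary using (Pred; _∈_)
open import Relation.Binary.PropositionalEquality using (_≡_; _≢_)

-- Process terms over data states S, messages M, process names PN
-- (labels omitted, as in the paper's presentation).
data Proc (S M PN : Set) : Set₁ where
  assign  : (S → S) → Proc S M PN → Proc S M PN
  guard   : (S → Pred S 0ℓ) → Proc S M PN → Proc S M PN
  send    : (S → M) → Proc S M PN → Proc S M PN
  receive : (M → S → S) → Proc S M PN → Proc S M PN
  _⊕_     : Proc S M PN → Proc S M PN → Proc S M PN
  call    : PN → Proc S M PN

infixr 5 _⊕_

data Action (M : Set) : Set where
  τ       : Action M
  sendA    : M → Action M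
  receiveA : M → Action M

State : (S M PN : Set) → Set₁
State S M PN = S × Proc S M PN

data Step {S M PN : Set} (Γ : PN → Proc S M PN)
     : State S M PN → Action M → State S M PN → Set₁ where
  s-assign  : ∀ {ξ u p} → Step Γ (ξ , assign u p) τ (u ξ , p)
  s-guard   : ∀ {ξ ξ' g p} → ξ' ∈ g ξ → Step Γ (ξ , guard g p) τ (ξ' , p)
  s-send    : ∀ {ξ s p} → Step Γ (ξ , send s p) (sendA (s ξ)) (ξ , p)
  s-receive : ∀ {ξ u p} (m : M) → Step Γ (ξ , receive u p) (receiveA m) (u m ξ , p)
  s-choiceˡ : ∀ {ξ p q a s'} → Step Γ (ξ , p) a s' → Step Γ (ξ , p ⊕ q) a s'
  s-choiceʳ : ∀ {ξ p q a s'} → Step Γ (ξ , q) a s' → Step Γ (ξ , p ⊕ q) a s'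
  s-call    : ∀ {ξ pn a s'} → Step Γ (ξ , Γ pn) a s' → Step Γ (ξ , call pn) a s'

record Automaton (St : Set₁) (Act : Set) : Set₂ where
  field
    init  : St → Set₁
    trans : St → Act → St → Set₁
open Automaton public

data reachable {St : Set₁} {Act : Set} (A : Automaton St Act) (I : Act → Set) : St → Set₂ where
  r-init : ∀ {s} → init A s → reachable A I s
  r-step : ∀ {s a s'} → reachable A I s → trans A s a s' → I a → reachable A I s'

data PName : Set where
  Qmsg : PName

-- Isabelle's hd is underspecified on []; we model it with an arbitrary default d
-- (the statement quantifies over d). tl [] = [] as in Isabelle.
hd : {M : Set} → M → List M → M
hd d []      = d
hd d (x ∷ _) = x

tl : {M : Set} → List M → List M
tl []       = []
tl (_ ∷ xs) = xs

Γqmsg : {M : Set} → M → PName → Proc (List M) M PName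
Γqmsg d Qmsg =
  receive (λ msg msgs → msgs ++ [ msg ]) (call Qmsg)
  ⊕ guard (λ msgs msgs' → msgs ≢ [] × msgs' ≡ msgs)
      ( send (λ msgs → hd d msgs)
          ( assign (λ msgs → tl msgs) (call Qmsg)
          ⊕ receive (λ msg msgs → tl msgs ++ [ msg ]) (call Qmsg))
      ⊕ receive (λ msg msgs → msgs ++ [ msg ]) (call Qmsg))

qmsg : {M : Set} → M → Automaton (State (List M) M PName) (Action M)
init  (qmsg d) s = s ≡ ([] , Γqmsg d Qmsg)
trans (qmsg d) s a s' = Step (Γqmsg d) s a s'

-- Every reachable control state is one of four subterms of Γqmsg (an inductive
-- invariant), so any step is one of the five alternatives of the specification.
-- Each either keeps the queue, drops its head, or appends the received message
-- to the queue or to its tail, and tl xs ⊆ xs covers all cases.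
module Submission where

open import Defs
open import Data.List using (List; []; _∷_; _++_; [_])
open import Data.List.Relation.Binary.Subset.Propositional using (_⊆_)
open import Data.List.Relation.Binary.Subset.Propositional.Properties
  using (⊆-refl; xs⊆x∷xs; ++⁺ˡ)
open import Data.Product using (_×_; _,_; proj₁; proj₂)
open import Data.Unit using (⊤)
open import Data.Empty using (⊥-elim)
open import Relation.Binary.PropositionalEquality using (_≡_; _≢_; refl)

module _ {M : Set} (d : M) where

  dequeue : Proc (List M) M PName
  dequeue = assign tl (call Qmsg)
          ⊕ receive (λ msg msgs → tl msgs ++ [ msg ]) (call Qmsg)

  nonEmpty : Proc (List M) M PName
  nonEmpty = send (hd d) dequeue
           ⊕ receive (λ msg msgs → msgs ++ [ msg ]) (call Qmsg)

  data Control : Proc (List M) M PName → Set₁ where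
    body     : Control (Γqmsg d Qmsg)
    called   : Control (call Qmsg)
    guarded  : Control nonEmpty
    dequeued : Control dequeue

tl⊆ : {M : Set} (xs : List M) → tl xs ⊆ xs
tl⊆ []       = ⊆-refl
tl⊆ (x ∷ xs) = xs⊆x∷xs xs x

data ContentsBound {M : Set} : Action M → List M → List M → Set where
  τ-bound       : ∀ {msgs msgs'} → msgs' ⊆ msgs → ContentsBound τ msgs msgs'
  send-bound    : ∀ {m msgs msgs'} → msgs' ⊆ msgs → ContentsBound (sendA m) msgs msgs'
  receive-bound : ∀ {m msgs msgs'} → msgs' ⊆ msgs ++ [ m ] → ContentsBound (receiveA m) msgs msgs'

StepOutcome : {M : Set} → M → Action M → List M → List M → Proc (List M) M PName → Set₁
StepOutcome d a msgs msgs' q' = Control d q' × ContentsBound a msgs msgs'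

module _ {M : Set} {d : M} where

  step-body : ∀ {msgs msgs' a q'}
    → Step (Γqmsg d) (msgs , Γqmsg d Qmsg) a (msgs' , q') → StepOutcome d a msgs msgs' q'
  step-body (s-choiceˡ (s-receive m))        = called , receive-bound ⊆-refl
  step-body (s-choiceʳ (s-guard (_ , refl))) = guarded , τ-bound ⊆-refl

  step-Control : ∀ {msgs msgs' a q q'} → Control d q
    → Step (Γqmsg d) (msgs , q) a (msgs' , q') → StepOutcome d a msgs msgs' q'
  step-Control         body     s                         = step-body s
  step-Control         called   (s-call s)                = step-body s
  step-Control         guarded  (s-choiceˡ s-send)        = dequeued , send-bound ⊆-refl
  step-Control         guarded  (s-choiceʳ (s-receive m)) = called , receive-bound ⊆-refl
  step-Control {msgs} dequeued (s-choiceˡ s-assign)      = called , τ-bound (tl⊆ msgs)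
  step-Control {msgs} dequeued (s-choiceʳ (s-receive m)) = called , receive-bound (++⁺ˡ [ m ] (tl⊆ msgs))

  reachable-Control : ∀ {I : Action M → Set} {msgs q}
    → reachable (qmsg d) I (msgs , q) → Control d q
  reachable-Control (r-init refl)  = body
  reachable-Control (r-step r t _) = proj₁ (step-Control (reachable-Control r) t)

ContentsBound-split : {M : Set} {a : Action M} {msgs msgs' : List M}
  → ContentsBound a msgs msgs'
  → ((m : M) → a ≡ receiveA m → msgs' ⊆ msgs ++ [ m ])
  × (((m : M) → a ≢ receiveA m) → msgs' ⊆ msgs)
ContentsBound-split (τ-bound ⊆msgs)         = (λ _ ()) , λ _ → ⊆msgs
ContentsBound-split (send-bound ⊆msgs)      = (λ _ ()) , λ _ → ⊆msgs
ContentsBound-split (receive-bound ⊆msgs+m) = (λ { _ refl → ⊆msgs+m }) , λ ≢receive → ⊥-elim (≢receive _ refl)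

lemma3 : {M : Set} (d : M) (msgs : List M) (q : Proc (List M) M PName)
    → reachable (qmsg d) (λ _ → ⊤) (msgs , q)
    → (a : Action M) (msgs' : List M) (q' : Proc (List M) M PName)
    → trans (qmsg d) (msgs , q) a (msgs' , q')
    → ((m : M) → a ≡ receiveA m → msgs' ⊆ msgs ++ [ m ])
    × (((m : M) → a ≢ receiveA m) → msgs' ⊆ msgs)
lemma3 d msgs q r a msgs' q' t =
  ContentsBound-split (proj₂ (step-Control (reachable-Control r) t))
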